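{- Let $R$ be a commutative ring with identity, let $L$ be a finite meet semilattice with Möbius function $\mu$, and let $f\in I(L,R)$. Suppose $S\subseteq L$ is meet closed, and fix a linear extension $a_1,a_2,\ldots,a_n$ of the partial order on $S$ (so that $a_i<a_j$ implies $i<j$). Let $(S)_f$ be the $n\times n$ matrix whose $(i,j)$ entry is $f(a_i\wedge a_j,\,a_i)$. Then $$\det(S)_f=\prod_{i=1}^n\left(\sum_{d\unlhd a_i}\ \sum_{c\in L}\mu(c,d)\,f(c,a_i)\right),$$ where the inner sum over $d$ ranges over all $d\in L$ with $d\unlhd a_i$.
   Context: For a finite poset $L$ and a commutative ring $R$ with identity, the incidence algebra $I(L,R)$ consists of all functions $F:L\times L\to R$ with $F(a,b)=0$ unless $a\le b$. The Möbius function $\mu\in I(L,R)$ is the inverse of the zeta function $\zeta$ ($\zeta(a,b)=1$ if $a\le b$, $0$ otherwise), i.e. the unique element with $\sum_{a\le c\le b}\mu(a,c)=\delta(a,b)$ for all $a\le b$ (and $\mu(a,b)=0$ unless $a\le b$). A meet semilattice is a poset in which every two elements $a,b$ have a greatest lower bound $a\wedge b$. A subset $S\subseteq L$ is meet closed if $a,b\in S$ implies $a\wedge b\in S$ (meet taken in $L$). For $d\in L$ and the fixed linear extension $a_1,\ldots,a_n$ of $S$, write $d\unlhd a_i$ if $d\le a_i$ and $d\not\le a_j$ for every $j<i$. -}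

module Defs where

open import Level using (Level; _⊔_)
open import Algebra.Bundles using (CommutativeRing)
open import Data.Nat using (ℕ) renaming (zero to z; suc to s)
open import Data.Fin using (Fin; zero; suc; punchIn; _<_; _<?_)
open import Data.Fin.Properties using (all?)
open import Data.Bool using (if_then_else_)
open import Data.Product using (_×_)
open import Relation.Binary.Core using (Rel)
open import Relation.Binary.Definitions using (Decidable)
open import Relation.Nullary using (¬_; Dec; does)
open import Relation.Nullary.Decidable using (¬?; _×-dec_; _→-dec_)

module RingOps {c ℓ : Level} (R : CommutativeRing c ℓ) where
  open CommutativeRing R hiding (zero)

  ∑ : ∀ {n} → (Fin n → Carrier) → Carrier
  ∑ {ℕ.zero}  g = 0#
  ∑ {ℕ.suc n} g = g zero + ∑ (λ i → g (suc i))

  ∏ : ∀ {n} → (Fin n → Carrier) → Carrier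
  ∏ {ℕ.zero}  g = 1#
  ∏ {ℕ.suc n} g = g zero * ∏ (λ i → g (suc i))

  ∑∣ : ∀ {n p} {P : Fin n → Set p} → ((x : Fin n) → Dec (P x)) →
       (Fin n → Carrier) → Carrier
  ∑∣ P? g = ∑ (λ x → if does (P? x) then g x else 0#)

  sign : ∀ {n} → Fin n → Carrier
  sign zero    = 1#
  sign (suc j) = - sign j

  det : ∀ {n} → (Fin n → Fin n → Carrier) → Carrier
  det {ℕ.zero}  M = 1#
  det {ℕ.suc n} M =
    ∑ (λ j → sign j * (M zero j * det (λ i k → M (suc i) (punchIn j k))))

  δ : ∀ {m} → Fin m → Fin m → Carrier
  δ a b = if does (a Data.Fin.≟ b) then 1# else 0#

  InIncidence : ∀ {m r} (_≤_ : Rel (Fin m) r) → (Fin m → Fin m → Carrier) → Set (r ⊔ ℓ)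
  InIncidence _≤_ F = ∀ a b → ¬ (a ≤ b) → F a b ≈ 0#

  -- μ is the Möbius function of the poset (Fin m, ≤): it lies in the
  -- incidence algebra and ∑_{a ≤ c ≤ b} μ(a,c) = δ(a,b) for all a ≤ b.
  -- (This characterises μ uniquely.)
  IsMobius : ∀ {m r} (_≤_ : Rel (Fin m) r) → Decidable _≤_ →
             (Fin m → Fin m → Carrier) → Set (r ⊔ ℓ)
  IsMobius _≤_ _≤?_ μ =
    InIncidence _≤_ μ ×
    (∀ a b → a ≤ b → ∑∣ (λ x → (a ≤? x) ×-dec (x ≤? b)) (μ a) ≈ δ a b)

⊴ : ∀ {m n r} (_≤_ : Rel (Fin m) r) (a : Fin n → Fin m) → Fin m → Fin n → Set r
⊴ _≤_ a d i = (d ≤ a i) × (∀ j → j < i → ¬ (d ≤ a j))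

⊴? : ∀ {m n r} {_≤_ : Rel (Fin m) r} → Decidable _≤_ → (a : Fin n → Fin m) →
     (i : Fin n) → (d : Fin m) → Dec (⊴ _≤_ a d i)
⊴? _≤?_ a i d = (d ≤? a i) ×-dec all? (λ j → (j <? i) →-dec ¬? (d ≤? a j))

-- The matrix factors as (S)_f = L U, with U_kj = [a_k ≤ a_j] upper unitriangular and
-- L_ik = [a_k ≤ a_i] ∑_{d ⊴ a_k} ∑_c μ(c,d) f(c,a_i) lower triangular. Indeed, every d lies
-- below a unique a_k with d ⊴ a_k, and since S is meet closed a_k is the least element of S
-- above d; so a_k ≤ a_i ∧ a_j exactly when d ≤ a_i ∧ a_j, and (L U)_ij is the sum over
-- d ≤ a_i ∧ a_j of ∑_c μ(c,d) f(c,a_i), which is f(a_i ∧ a_j, a_i) by Möbius inversion.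
-- The determinant of such a product is ∏ L_ii: column operations against column 0 clear the
-- first row and leave the same situation in the minor.
module Submission where

open import Defs
open import Level using (Level)
open import Algebra.Bundles using (CommutativeRing)
open import Data.Nat using (ℕ)
open import Data.Fin using (Fin; _<_)
open import Data.Product using (Σ; _×_)
open import Function.Definitions using (Injective)
open import Relation.Binary.Core using (Rel)
open import Relation.Binary.Definitions using (Decidable)
open import Relation.Binary.Lattice.Structures using (IsMeetSemilattice)
open import Relation.Binary.PropositionalEquality using (_≡_; _≢_)

import Algebra.Properties.Semiring.Sum as SemiringSum
open import Data.Bool using (if_then_else_)
open import Data.Empty using (⊥-elim)
open import Data.Fin using (zero; suc; punchIn; punchOut; toℕ; fromℕ<; _≟_)
open import Data.Fin.Properties
  using (<-cmp; <-irrefl; <-asym; punchInᵢ≢i; punchIn-injective; punchIn-punchOut; toℕ<n; toℕ-fromℕ<; toℕ-injective)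
import Data.Nat as ℕ
open import Data.Nat using (z<s; s<s)
import Data.Nat.Properties as ℕ
open import Data.Product using (_,_; proj₁; proj₂)
open import Data.Vec.Functional using (updateAt)
open import Data.Vec.Functional.Properties using (updateAt-updates; updateAt-minimal)
open import Function using (_∘_)
open import Relation.Binary.Definitions using (tri<; tri≈; tri>)
import Relation.Binary.PropositionalEquality as ≡
open import Relation.Binary.Structures using (IsPreorder)
open import Relation.Nullary using (¬_; Dec; does; yes; no)
open import Relation.Nullary.Decidable using (_×-dec_)

punchOutOf : ∀ {n} → Fin (ℕ.suc (ℕ.suc n)) → Fin (ℕ.suc n) → Fin (ℕ.suc n)
punchOutOf zero    j       = zero
punchOutOf (suc c) zero    = c
punchOutOf {ℕ.suc n} (suc c) (suc j) = suc (punchOutOf c j)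

punchIn-punchOutOf : ∀ {n} (c : Fin (ℕ.suc (ℕ.suc n))) j → punchIn (punchIn c j) (punchOutOf c j) ≡ c
punchIn-punchOutOf zero    j       = ≡.refl
punchIn-punchOutOf (suc c) zero    = ≡.refl
punchIn-punchOutOf {ℕ.suc n} (suc c) (suc j) = ≡.cong suc (punchIn-punchOutOf c j)

punchIn-punchIn : ∀ {n} (c : Fin (ℕ.suc (ℕ.suc n))) j k →
                  punchIn c (punchIn j k) ≡ punchIn (punchIn c j) (punchIn (punchOutOf c j) k)
punchIn-punchIn zero    j       k       = ≡.refl
punchIn-punchIn (suc c) zero    k       = ≡.refl
punchIn-punchIn {ℕ.suc n} (suc c) (suc j) zero    = ≡.refl
punchIn-punchIn {ℕ.suc n} (suc c) (suc j) (suc k) = ≡.cong suc (punchIn-punchIn c j k)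

toFront : ∀ {n} → Fin (ℕ.suc n) → Fin (ℕ.suc n) → Fin (ℕ.suc n)
toFront c zero    = c
toFront c (suc k) = punchIn c k

toFront-punchIn : ∀ {n} (c : Fin (ℕ.suc (ℕ.suc n))) j k →
                  toFront c (punchIn (suc j) k) ≡ punchIn (punchIn c j) (toFront (punchOutOf c j) k)
toFront-punchIn c j zero    = ≡.sym (punchIn-punchOutOf c j)
toFront-punchIn c j (suc k) = punchIn-punchIn c j k

least-witness : ∀ {n p} {P : Fin n → Set p} → (∀ k → Dec (P k)) → ∀ i → P i →
                Σ (Fin n) (λ k → P k × (∀ j → j < k → ¬ P j))
least-witness {ℕ.suc n} P? i Pi with P? zero
... | yes P0 = zero , P0 , λ _ ()
least-witness {ℕ.suc n} P? zero    P0 | no ¬P0 = ⊥-elim (¬P0 P0)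
least-witness {ℕ.suc n} P? (suc i) Pi | no ¬P0 with least-witness (P? ∘ suc) i Pi
... | k , Pk , below-k = suc k , Pk , λ { zero _ → ¬P0 ; (suc j) (s<s j<k) → below-k j j<k }

module Sums {c ℓ} (R : CommutativeRing c ℓ) where
  open CommutativeRing R hiding (zero)
  open RingOps R
  open import Relation.Binary.Reasoning.Setoid setoid
  private module Sum = SemiringSum semiring

  ∑≡sum : ∀ {n} (g : Fin n → Carrier) → ∑ g ≡ Sum.sum g
  ∑≡sum {ℕ.zero}  g = ≡.refl
  ∑≡sum {ℕ.suc n} g = ≡.cong (g zero +_) (∑≡sum (g ∘ suc))

  ∑-cong : ∀ {n} {f g : Fin n → Carrier} → (∀ i → f i ≈ g i) → ∑ f ≈ ∑ g
  ∑-cong {f = f} {g} f≈g = begin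
    ∑ f       ≡⟨ ∑≡sum f ⟩
    Sum.sum f ≈⟨ Sum.sum-cong-≋ f≈g ⟩
    Sum.sum g ≡⟨ ∑≡sum g ⟨
    ∑ g       ∎

  ∑-zero : ∀ {n} {f : Fin n → Carrier} → (∀ i → f i ≈ 0#) → ∑ f ≈ 0#
  ∑-zero {n} {f} f≈0 = begin
    ∑ f                          ≡⟨ ∑≡sum f ⟩
    Sum.sum f                    ≈⟨ Sum.sum-cong-≋ f≈0 ⟩
    Sum.sum {n} (λ _ → 0#)       ≈⟨ Sum.sum-replicate-zero n ⟩
    0#                           ∎

  ∑-distrib-+ : ∀ {n} (f g : Fin n → Carrier) → ∑ (λ i → f i + g i) ≈ ∑ f + ∑ g
  ∑-distrib-+ f g = begin
    ∑ (λ i → f i + g i)       ≡⟨ ∑≡sum (λ i → f i + g i) ⟩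
    Sum.sum (λ i → f i + g i) ≈⟨ Sum.∑-distrib-+ f g ⟩
    Sum.sum f + Sum.sum g     ≡⟨ ≡.cong₂ _+_ (∑≡sum f) (∑≡sum g) ⟨
    ∑ f + ∑ g                 ∎

  *-distribˡ-∑ : ∀ {n} x (f : Fin n → Carrier) → x * ∑ f ≈ ∑ (λ i → x * f i)
  *-distribˡ-∑ x f = begin
    x * ∑ f                   ≡⟨ ≡.cong (x *_) (∑≡sum f) ⟩
    x * Sum.sum f             ≈⟨ Sum.*-distribˡ-sum x f ⟩
    Sum.sum (λ i → x * f i)   ≡⟨ ∑≡sum (λ i → x * f i) ⟨
    ∑ (λ i → x * f i)         ∎

  *-distribʳ-∑ : ∀ {n} x (f : Fin n → Carrier) → ∑ f * x ≈ ∑ (λ i → f i * x)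
  *-distribʳ-∑ x f = begin
    ∑ f * x                   ≡⟨ ≡.cong (_* x) (∑≡sum f) ⟩
    Sum.sum f * x             ≈⟨ Sum.*-distribʳ-sum x f ⟩
    Sum.sum (λ i → f i * x)   ≡⟨ ∑≡sum (λ i → f i * x) ⟨
    ∑ (λ i → f i * x)         ∎

  ∑-comm : ∀ {m n} (h : Fin m → Fin n → Carrier) →
           ∑ (λ i → ∑ (λ j → h i j)) ≈ ∑ (λ j → ∑ (λ i → h i j))
  ∑-comm h = begin
    ∑ (λ i → ∑ (λ j → h i j))             ≡⟨ ∑∑≡sumsum h ⟩
    Sum.sum (λ i → Sum.sum (λ j → h i j)) ≈⟨ Sum.∑-comm h ⟩
    Sum.sum (λ j → Sum.sum (λ i → h i j)) ≡⟨ ∑∑≡sumsum (λ j i → h i j) ⟨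
    ∑ (λ j → ∑ (λ i → h i j))             ∎
    where
      ∑∑≡sumsum : ∀ {m n} (h : Fin m → Fin n → Carrier) →
                  ∑ (λ i → ∑ (h i)) ≡ Sum.sum (λ i → Sum.sum (h i))
      ∑∑≡sumsum h = ≡.trans (∑≡sum (λ i → ∑ (h i))) (Sum.sum-cong-≗ (λ i → ∑≡sum (h i)))

  ∑-remove : ∀ {n} (f : Fin (ℕ.suc n) → Carrier) i → ∑ f ≈ f i + ∑ (λ k → f (punchIn i k))
  ∑-remove f i = begin
    ∑ f                                ≡⟨ ∑≡sum f ⟩
    Sum.sum f                          ≈⟨ Sum.sum-remove f ⟩
    f i + Sum.sum (λ k → f (punchIn i k)) ≡⟨ ≡.cong (f i +_) (∑≡sum (λ k → f (punchIn i k))) ⟨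
    f i + ∑ (λ k → f (punchIn i k))    ∎

  ∑-single : ∀ {n} (f : Fin n → Carrier) i → (∀ k → k ≢ i → f k ≈ 0#) → ∑ f ≈ f i
  ∑-single {ℕ.suc n} f i others≈0 = begin
    ∑ f                             ≈⟨ ∑-remove f i ⟩
    f i + ∑ (λ k → f (punchIn i k)) ≈⟨ +-congˡ (∑-zero (λ k → others≈0 _ (punchInᵢ≢i i k))) ⟩
    f i + 0#                        ≈⟨ +-identityʳ _ ⟩
    f i                             ∎

  ∏-cong : ∀ {n} {f g : Fin n → Carrier} → (∀ i → f i ≈ g i) → ∏ f ≈ ∏ g
  ∏-cong {ℕ.zero}  f≈g = refl
  ∏-cong {ℕ.suc n} f≈g = *-cong (f≈g zero) (∏-cong (f≈g ∘ suc))

  when : ∀ {p} {P : Set p} → Dec P → Carrier → Carrier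
  when P? x = if does P? then x else 0#

  module _ {p} {P : Set p} where

    when-yes : (P? : Dec P) {x : Carrier} → P → when P? x ≈ x
    when-yes (yes _)  _ = refl
    when-yes (no ¬p)  p = ⊥-elim (¬p p)

    when-no : (P? : Dec P) {x : Carrier} → ¬ P → when P? x ≈ 0#
    when-no (yes p) ¬p = ⊥-elim (¬p p)
    when-no (no _)  _  = refl

    when-cong : (P? : Dec P) {x y : Carrier} → x ≈ y → when P? x ≈ when P? y
    when-cong (yes _) x≈y = x≈y
    when-cong (no _)  _   = refl

    when-∑ : (P? : Dec P) {n : ℕ} (f : Fin n → Carrier) → when P? (∑ f) ≈ ∑ (λ i → when P? (f i))
    when-∑ (yes _) f = refl
    when-∑ (no _) {n} f = sym (∑-zero {n} {λ _ → 0#} (λ _ → refl))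

    *-when-1# : (P? : Dec P) (x : Carrier) → x * when P? 1# ≈ when P? x
    *-when-1# (yes _) x = *-identityʳ x
    *-when-1# (no _)  x = zeroʳ x

    when-*ʳ : (P? : Dec P) (x y : Carrier) → when P? x * y ≈ when P? (x * y)
    when-*ʳ (yes _) x y = refl
    when-*ʳ (no _)  x y = zeroˡ y

    when-when : ∀ {q} {Q : Set q} (P? : Dec P) (Q? : Dec Q) x → when P? (when Q? x) ≈ when (P? ×-dec Q?) x
    when-when (yes _) (yes _) x = refl
    when-when (yes _) (no _)  x = refl
    when-when (no _)  Q?      x = refl

  ∑-when-unique : ∀ {n p q} {P : Fin n → Set p} {Q : Set q} (P? : ∀ k → Dec (P k)) (Q? : Dec Q) →
                  (∀ {k l} → P k → P l → k ≡ l) → (∀ {k} → P k → Q) → (Q → Σ (Fin n) P) →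
                  ∀ x → ∑ (λ k → when (P? k) x) ≈ when Q? x
  ∑-when-unique P? Q? unique P⇒Q Q⇒P x with Q?
  ... | no ¬Q = ∑-zero (λ k → when-no (P? k) (¬Q ∘ P⇒Q))
  ... | yes q with Q⇒P q
  ...   | k₀ , Pk₀ = begin
    ∑ (λ k → when (P? k) x) ≈⟨ ∑-single _ k₀ (λ k k≢k₀ → when-no (P? k) (λ Pk → k≢k₀ (unique Pk Pk₀))) ⟩
    when (P? k₀) x          ≈⟨ when-yes (P? k₀) Pk₀ ⟩
    x                       ∎

module Determinants {c ℓ} (R : CommutativeRing c ℓ) where
  open CommutativeRing R hiding (zero)
  open RingOps R
  open Sums R
  open import Relation.Binary.Reasoning.Setoid setoid
  open import Algebra.Properties.Ring ring using (-‿distribˡ-*; -‿distribʳ-*; -‿involutive; -1*x≈-x)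
  open import Algebra.Solver.Ring.NaturalCoefficients.Default commutativeSemiring
    using (solve; _:=_; _:+_; _:*_)

  neg-*-neg : ∀ x y → - x * - y ≈ x * y
  neg-*-neg x y = begin
    - x * - y     ≈⟨ -‿distribˡ-* x (- y) ⟨
    - (x * - y)   ≈⟨ -‿cong (-‿distribʳ-* x y) ⟨
    - - (x * y)   ≈⟨ -‿involutive (x * y) ⟩
    x * y         ∎

  *-comm-cancel : ∀ x y → x * y + - y * x ≈ 0#
  *-comm-cancel x y = begin
    x * y + - y * x   ≈⟨ +-congˡ (-‿distribˡ-* y x) ⟨
    x * y + - (y * x) ≈⟨ +-congˡ (-‿cong (*-comm y x)) ⟩
    x * y + - (x * y) ≈⟨ -‿inverseʳ _ ⟩
    0#                ∎

  Matrix : ℕ → Set c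
  Matrix n = Fin n → Fin n → Carrier

  minor : ∀ {n} → Matrix (ℕ.suc n) → Fin (ℕ.suc n) → Matrix n
  minor M j i k = M (suc i) (punchIn j k)

  cofactorTerm : ∀ {n} → Matrix (ℕ.suc n) → Fin (ℕ.suc n) → Carrier
  cofactorTerm M j = sign j * (M zero j * det (minor M j))

  det-cong : ∀ {n} {A B : Matrix n} → (∀ i k → A i k ≈ B i k) → det A ≈ det B
  det-cong {ℕ.zero}  _   = refl
  det-cong {ℕ.suc n} A≈B = ∑-cong λ j →
    *-congˡ {sign j} (*-cong (A≈B zero j) (det-cong (λ i k → A≈B (suc i) (punchIn j k))))

  minor-avoiding : ∀ {n} {A B : Matrix (ℕ.suc n)} c → (∀ i k → k ≢ c → A i k ≈ B i k) →
                   ∀ i k → minor A c i k ≈ minor B c i k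
  minor-avoiding c A≈B i k = A≈B (suc i) (punchIn c k) (punchInᵢ≢i c k)

  minor-agrees : ∀ {n} {A B : Matrix (ℕ.suc n)} {c j} (j≢c : j ≢ c) → (∀ i k → k ≢ c → A i k ≈ B i k) →
                 ∀ i k → k ≢ punchOut j≢c → minor A j i k ≈ minor B j i k
  minor-agrees {j = j} j≢c A≈B i k k≢c′ = A≈B (suc i) (punchIn j k) λ eq →
    k≢c′ (punchIn-injective j k _ (≡.trans eq (≡.sym (punchIn-punchOut j≢c))))

  det-linear-column : ∀ {n} (c : Fin n) (A B C : Matrix n) (t : Carrier) →
    (∀ i k → k ≢ c → A i k ≈ B i k) → (∀ i k → k ≢ c → C i k ≈ B i k) →
    (∀ i → A i c ≈ B i c + t * C i c) → det A ≈ det B + t * det C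
  det-linear-column {ℕ.suc n} c A B C t A≈B C≈B Ac = begin
    det A                                             ≈⟨ ∑-cong expand ⟩
    ∑ (λ j → cofactorTerm B j + t * cofactorTerm C j) ≈⟨ ∑-distrib-+ (cofactorTerm B) (λ j → t * cofactorTerm C j) ⟩
    det B + ∑ (λ j → t * cofactorTerm C j)            ≈⟨ +-congˡ (*-distribˡ-∑ t (cofactorTerm C)) ⟨
    det B + t * det C                                 ∎
    where
      expand : ∀ j → cofactorTerm A j ≈ cofactorTerm B j + t * cofactorTerm C j
      expand j with j ≟ c
      ... | yes ≡.refl = begin
        sign j * (A zero j * det (minor A j))
          ≈⟨ *-congˡ (*-cong (Ac zero) (det-cong (minor-avoiding c A≈B))) ⟩
        sign j * ((B zero j + t * C zero j) * det (minor B j))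
          ≈⟨ solve 5 (λ s b t x d → s :* ((b :+ t :* x) :* d) := s :* (b :* d) :+ t :* (s :* (x :* d))) refl _ _ _ _ _ ⟩
        cofactorTerm B j + t * (sign j * (C zero j * det (minor B j)))
          ≈⟨ +-congˡ (*-congˡ (*-congˡ (*-congˡ (det-cong (minor-avoiding c C≈B))))) ⟨
        cofactorTerm B j + t * cofactorTerm C j ∎
      ... | no j≢c = begin
        sign j * (A zero j * det (minor A j))
          ≈⟨ *-congˡ (*-cong (A≈B zero j j≢c) minor-linear) ⟩
        sign j * (B zero j * (det (minor B j) + t * det (minor C j)))
          ≈⟨ solve 5 (λ s b t d e → s :* (b :* (d :+ t :* e)) := s :* (b :* d) :+ t :* (s :* (b :* e))) refl _ _ _ _ _ ⟩
        cofactorTerm B j + t * (sign j * (B zero j * det (minor C j)))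
          ≈⟨ +-congˡ (*-congˡ (*-congˡ (*-congʳ (C≈B zero j j≢c)))) ⟨
        cofactorTerm B j + t * cofactorTerm C j ∎
        where
          minor-linear : det (minor A j) ≈ det (minor B j) + t * det (minor C j)
          minor-linear = det-linear-column (punchOut j≢c) (minor A j) (minor B j) (minor C j) t
            (minor-agrees j≢c A≈B) (minor-agrees j≢c C≈B)
            (λ i → ≡.subst (λ k → A (suc i) k ≈ B (suc i) k + t * C (suc i) k)
                           (≡.sym (punchIn-punchOut j≢c)) (Ac (suc i)))

  sign-*-sign : ∀ {n} (c : Fin n) → sign c * sign c ≈ 1#
  sign-*-sign zero    = *-identityˡ 1#
  sign-*-sign (suc c) = trans (neg-*-neg (sign c) (sign c)) (sign-*-sign c)

  sign-cancel : ∀ {n} (c : Fin n) x → sign c * (sign c * x) ≈ x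
  sign-cancel c x = begin
    sign c * (sign c * x) ≈⟨ *-assoc _ _ x ⟨
    (sign c * sign c) * x ≈⟨ *-congʳ (sign-*-sign c) ⟩
    1# * x                ≈⟨ *-identityˡ x ⟩
    x                     ∎

  sign-punchIn : ∀ {n} (c : Fin (ℕ.suc (ℕ.suc n))) j →
                 sign c * sign (punchIn c j) ≈ - (sign j * sign (punchOutOf c j))
  sign-punchIn zero    j    = trans (*-identityˡ _) (-‿cong (sym (*-identityʳ _)))
  sign-punchIn (suc c) zero = trans (*-identityʳ _) (-‿cong (sym (*-identityˡ _)))
  sign-punchIn {ℕ.suc n} (suc c) (suc j) = begin
    - sign c * - sign (punchIn c j)              ≈⟨ neg-*-neg _ _ ⟩
    sign c * sign (punchIn c j)                  ≈⟨ sign-punchIn c j ⟩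
    - (sign j * sign (punchOutOf c j))           ≈⟨ -‿cong (neg-*-neg _ _) ⟨
    - (- sign j * - sign (punchOutOf c j))       ∎

  det-toFront : ∀ {n} (M : Matrix (ℕ.suc n)) c → det (λ i k → M i (toFront c k)) ≈ sign c * det M
  det-toFront {ℕ.zero}  M zero = sym (*-identityˡ _)
  det-toFront {ℕ.suc n} M c = begin
    1# * (M zero c * det (minor M c)) + ∑ (λ j → - sign j * (M zero (punchIn c j) * det (minor M′ (suc j))))
      ≈⟨ +-cong (trans (*-identityˡ _) (sym (sign-cancel c _))) (∑-cong moved) ⟩
    sign c * cofactorTerm M c + ∑ (λ j → sign c * cofactorTerm M (punchIn c j))
      ≈⟨ +-congˡ (*-distribˡ-∑ (sign c) (λ j → cofactorTerm M (punchIn c j))) ⟨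
    sign c * cofactorTerm M c + sign c * ∑ (λ j → cofactorTerm M (punchIn c j))
      ≈⟨ distribˡ _ _ _ ⟨
    sign c * (cofactorTerm M c + ∑ (λ j → cofactorTerm M (punchIn c j)))
      ≈⟨ *-congˡ (∑-remove (cofactorTerm M) c) ⟨
    sign c * det M ∎
    where
      M′ : Matrix (ℕ.suc (ℕ.suc n))
      M′ i k = M i (toFront c k)
      moved : ∀ j → - sign j * (M zero (punchIn c j) * det (minor M′ (suc j)))
                    ≈ sign c * cofactorTerm M (punchIn c j)
      moved j = begin
        - sign j * (M zero p * det (minor M′ (suc j)))
          ≈⟨ *-congˡ (*-congˡ (det-cong (λ i k → reflexive (≡.cong (M (suc i)) (toFront-punchIn c j k))))) ⟩
        - sign j * (M zero p * det (λ i k → minor M p i (toFront o k)))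
          ≈⟨ *-congˡ (*-congˡ (det-toFront (minor M p) o)) ⟩
        - sign j * (M zero p * (sign o * det (minor M p)))
          ≈⟨ solve 4 (λ s m t d → s :* (m :* (t :* d)) := (s :* t) :* (m :* d)) refl _ _ _ _ ⟩
        (- sign j * sign o) * (M zero p * det (minor M p))
          ≈⟨ *-congʳ (trans (sym (-‿distribˡ-* _ _)) (sym (sign-punchIn c j))) ⟩
        (sign c * sign p) * (M zero p * det (minor M p))
          ≈⟨ *-assoc _ _ _ ⟩
        sign c * cofactorTerm M p ∎
        where
          p = punchIn c j
          o = punchOutOf c j

  det-columns₀₁-equal : ∀ {n} (M : Matrix (ℕ.suc (ℕ.suc n))) → (∀ i → M i zero ≈ M i (suc zero)) → det M ≈ 0#
  det-columns₀₁-equal {n} M col₀≈col₁ = begin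
    cofactorTerm M zero + (cofactorTerm M (suc zero) + ∑ (λ j → cofactorTerm M (suc (suc j))))
      ≈⟨ +-assoc _ _ _ ⟨
    (cofactorTerm M zero + cofactorTerm M (suc zero)) + ∑ (λ j → cofactorTerm M (suc (suc j)))
      ≈⟨ +-cong first-two-cancel (∑-zero λ j → cofactorTerm-zero {N = M} (minor-vanishes M col₀≈col₁ j)) ⟩
    0# + 0#
      ≈⟨ +-identityʳ 0# ⟩
    0# ∎
    where
      cofactorTerm-zero : ∀ {k} {N : Matrix (ℕ.suc k)} {j} → det (minor N j) ≈ 0# → cofactorTerm N j ≈ 0#
      cofactorTerm-zero D≈0 = trans (*-congˡ (trans (*-congˡ D≈0) (zeroʳ _))) (zeroʳ _)

      minor-vanishes : ∀ {k} (N : Matrix (ℕ.suc (ℕ.suc k))) → (∀ i → N i zero ≈ N i (suc zero)) →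
                       (j : Fin k) → det (minor N (suc (suc j))) ≈ 0#
      minor-vanishes {ℕ.suc k} N N-col₀≈col₁ j = det-columns₀₁-equal (minor N (suc (suc j))) (N-col₀≈col₁ ∘ suc)

      minor₀≈minor₁ : ∀ i k → minor M zero i k ≈ minor M (suc zero) i k
      minor₀≈minor₁ i zero    = sym (col₀≈col₁ (suc i))
      minor₀≈minor₁ i (suc k) = refl

      first-two-cancel : cofactorTerm M zero + cofactorTerm M (suc zero) ≈ 0#
      first-two-cancel = begin
        1# * X + - 1# * (M zero (suc zero) * det (minor M (suc zero)))
          ≈⟨ +-cong (*-identityˡ X) (-1*x≈-x _) ⟩
        X + - (M zero (suc zero) * det (minor M (suc zero)))
          ≈⟨ +-congˡ (-‿cong (*-cong (col₀≈col₁ zero) (det-cong minor₀≈minor₁))) ⟨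
        X + - X
          ≈⟨ -‿inverseʳ X ⟩
        0# ∎
        where X = M zero zero * det (minor M zero)

  det-repeated-column₀ : ∀ {n} (M : Matrix (ℕ.suc n)) (c : Fin n) → (∀ i → M i zero ≈ M i (suc c)) → det M ≈ 0#
  det-repeated-column₀ {ℕ.suc n} M c col₀≈col = begin
    det M                                                ≈⟨ sign-cancel (suc c) (det M) ⟨
    sign (suc c) * (sign (suc c) * det M)                ≈⟨ *-congˡ (det-toFront M (suc c)) ⟨
    sign (suc c) * det (λ i k → M i (toFront (suc c) k)) ≈⟨ *-congˡ (det-columns₀₁-equal (λ i k → M i (toFront (suc c) k)) (sym ∘ col₀≈col)) ⟩
    sign (suc c) * 0#                                    ≈⟨ zeroʳ _ ⟩
    0#                                                   ∎

  det-add-column₀ : ∀ {n} (A B : Matrix (ℕ.suc n)) (c : Fin n) (t : Carrier) →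
    (∀ i k → k ≢ suc c → A i k ≈ B i k) → (∀ i → A i (suc c) ≈ B i (suc c) + t * B i zero) → det A ≈ det B
  det-add-column₀ A B c t A≈B Ac = begin
    det A             ≈⟨ det-linear-column (suc c) A B C t A≈B C≈B (λ i → trans (Ac i) (+-congˡ (*-congˡ (C-col i)))) ⟩
    det B + t * det C ≈⟨ +-congˡ (trans (*-congˡ (det-repeated-column₀ C c C-repeats)) (zeroʳ t)) ⟩
    det B + 0#        ≈⟨ +-identityʳ _ ⟩
    det B             ∎
    where
      C : Matrix _
      C i = updateAt (B i) (suc c) (λ _ → B i zero)
      C≈B : ∀ i k → k ≢ suc c → C i k ≈ B i k
      C≈B i k k≢c = reflexive (updateAt-minimal k (suc c) (B i) k≢c)
      C-col : ∀ i → B i zero ≈ C i (suc c)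
      C-col i = reflexive (≡.sym (updateAt-updates (suc c) (B i)))
      C-repeats : ∀ i → C i zero ≈ C i (suc c)
      C-repeats i = trans (C≈B i zero (λ ())) (C-col i)

  addColumn₀ : ∀ {n} → Matrix (ℕ.suc n) → (Fin n → Carrier) → Matrix (ℕ.suc n)
  addColumn₀ M w i zero    = M i zero
  addColumn₀ M w i (suc k) = M i (suc k) + w k * M i zero

  addColumn₀-cong : ∀ {n} (M : Matrix (ℕ.suc n)) {u v : Fin n → Carrier} → (∀ k → u k ≈ v k) →
                    ∀ i k → addColumn₀ M u i k ≈ addColumn₀ M v i k
  addColumn₀-cong M u≈v i zero    = refl
  addColumn₀-cong M u≈v i (suc k) = +-congˡ (*-congʳ (u≈v k))

  _↾_ : ∀ {n} → (Fin n → Carrier) → ℕ → Fin n → Carrier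
  (w ↾ m) k = when (toℕ k ℕ.<? m) (w k)

  ↾-suc : ∀ {n} (w : Fin n → Carrier) m k → toℕ k ≢ m → (w ↾ ℕ.suc m) k ≈ (w ↾ m) k
  ↾-suc w m k k≢m with toℕ k ℕ.<? m
  ... | yes k<m = trans (when-yes (toℕ k ℕ.<? ℕ.suc m) (ℕ.m<n⇒m<1+n k<m)) (sym (when-yes (toℕ k ℕ.<? m) k<m))
  ... | no  k≮m = trans (when-no (toℕ k ℕ.<? ℕ.suc m) (λ k<1+m → k≮m (ℕ.≤∧≢⇒< (ℕ.s≤s⁻¹ k<1+m) k≢m)))
                        (sym (when-no (toℕ k ℕ.<? m) k≮m))

  ↾-full : ∀ {n} (w : Fin n → Carrier) k → (w ↾ n) k ≈ w k
  ↾-full {n} w k = when-yes (toℕ k ℕ.<? n) (toℕ<n k)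

  det-addColumn₀-↾ : ∀ {n} (M : Matrix (ℕ.suc n)) w m → det (addColumn₀ M (w ↾ m)) ≈ det M
  det-addColumn₀-↾ M w ℕ.zero = det-cong {A = addColumn₀ M (w ↾ 0)} {B = M} λ where
    i zero    → refl
    i (suc k) → trans (+-congˡ (zeroˡ _)) (+-identityʳ _)
  det-addColumn₀-↾ {n} M w (ℕ.suc m) with m ℕ.<? n
  ... | no m≮n = trans (det-cong (addColumn₀-cong M λ k → ↾-suc w m k λ k≡m → m≮n (≡.subst (ℕ._< n) k≡m (toℕ<n k))))
                       (det-addColumn₀-↾ M w m)
  ... | yes m<n = trans (det-add-column₀ _ _ k₀ (w k₀) others column-k₀) (det-addColumn₀-↾ M w m)
    where
      k₀ = fromℕ< m<n
      others : ∀ i k → k ≢ suc k₀ → addColumn₀ M (w ↾ ℕ.suc m) i k ≈ addColumn₀ M (w ↾ m) i k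
      others i zero    _     = refl
      others i (suc k) k≢k₀ = +-congˡ (*-congʳ (↾-suc w m k λ k≡m →
        k≢k₀ (≡.cong suc (toℕ-injective (≡.trans k≡m (≡.sym (toℕ-fromℕ< m<n)))))))
      column-k₀ : ∀ i → addColumn₀ M (w ↾ ℕ.suc m) i (suc k₀) ≈ addColumn₀ M (w ↾ m) i (suc k₀) + w k₀ * M i zero
      column-k₀ i = begin
        M i (suc k₀) + (w ↾ ℕ.suc m) k₀ * M i zero
          ≈⟨ +-congˡ (*-congʳ (when-yes (toℕ k₀ ℕ.<? ℕ.suc m) (ℕ.≤-reflexive (≡.cong ℕ.suc (toℕ-fromℕ< m<n))))) ⟩
        M i (suc k₀) + w k₀ * M i zero
          ≈⟨ +-congʳ (+-identityʳ _) ⟨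
        (M i (suc k₀) + 0#) + w k₀ * M i zero
          ≈⟨ +-congʳ (+-congˡ (zeroˡ _)) ⟨
        (M i (suc k₀) + 0# * M i zero) + w k₀ * M i zero
          ≈⟨ +-congʳ (+-congˡ (*-congʳ (when-no (toℕ k₀ ℕ.<? m) (ℕ.<-irrefl (toℕ-fromℕ< m<n))))) ⟨
        (M i (suc k₀) + (w ↾ m) k₀ * M i zero) + w k₀ * M i zero ∎

  det-addColumn₀ : ∀ {n} (M : Matrix (ℕ.suc n)) w → det (addColumn₀ M w) ≈ det M
  det-addColumn₀ {n} M w = trans (det-cong (addColumn₀-cong M (sym ∘ ↾-full w))) (det-addColumn₀-↾ M w n)

  det-row₀-sparse : ∀ {n} (M : Matrix (ℕ.suc n)) → (∀ k → M zero (suc k) ≈ 0#) →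
                    det M ≈ M zero zero * det (minor M zero)
  det-row₀-sparse M row₀≈0 = begin
    1# * (M zero zero * det (minor M zero)) + ∑ (λ k → cofactorTerm M (suc k))
      ≈⟨ +-cong (*-identityˡ _) (∑-zero λ k → trans (*-congˡ (trans (*-congʳ (row₀≈0 k)) (zeroˡ _))) (zeroʳ _)) ⟩
    M zero zero * det (minor M zero) + 0#
      ≈⟨ +-identityʳ _ ⟩
    M zero zero * det (minor M zero) ∎

  det-LU : ∀ {n} (L U M : Matrix n) →
    (∀ i k → i < k → L i k ≈ 0#) → (∀ k j → j < k → U k j ≈ 0#) → (∀ k → U k k ≈ 1#) →
    (∀ i j → M i j ≈ ∑ (λ k → L i k * U k j)) → det M ≈ ∏ (λ i → L i i)
  det-LU {ℕ.zero}  _ _ _ _ _ _ _ = refl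
  det-LU {ℕ.suc n} L U M L-lower U-upper U-diag M≈LU = begin
    det M                                     ≈⟨ det-addColumn₀ M w ⟨
    det M′                                    ≈⟨ det-row₀-sparse M′ M′-row₀ ⟩
    M zero zero * det (minor M′ zero)         ≈⟨ *-cong (M-column₀ zero) trailing ⟩
    L zero zero * ∏ (λ i → L (suc i) (suc i)) ∎
    where
      w : Fin n → Carrier
      w k = - U zero (suc k)

      M′ : Matrix (ℕ.suc n)
      M′ = addColumn₀ M w

      M-row₀ : ∀ j → M zero j ≈ L zero zero * U zero j
      M-row₀ j = trans (M≈LU zero j) (∑-single (λ k → L zero k * U k j) zero λ where
        zero    0≢0 → ⊥-elim (0≢0 ≡.refl)
        (suc k) _   → trans (*-congʳ (L-lower zero (suc k) z<s)) (zeroˡ _))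

      M-column₀ : ∀ i → M i zero ≈ L i zero
      M-column₀ i = begin
        M i zero
          ≈⟨ M≈LU i zero ⟩
        L i zero * U zero zero + ∑ (λ k → L i (suc k) * U (suc k) zero)
          ≈⟨ +-cong (trans (*-congˡ (U-diag zero)) (*-identityʳ _))
                    (∑-zero λ k → trans (*-congˡ (U-upper (suc k) zero z<s)) (zeroʳ _)) ⟩
        L i zero + 0#
          ≈⟨ +-identityʳ _ ⟩
        L i zero ∎

      M′-row₀ : ∀ k → M′ zero (suc k) ≈ 0#
      M′-row₀ k = trans (+-cong (M-row₀ (suc k)) (*-congˡ (M-column₀ zero))) (*-comm-cancel _ _)

      M′-minor : ∀ i k → minor M′ zero i k ≈ ∑ (λ l → L (suc i) (suc l) * U (suc l) (suc k))
      M′-minor i k = begin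
        M (suc i) (suc k) + w k * M (suc i) zero
          ≈⟨ +-cong (M≈LU (suc i) (suc k)) (*-congˡ (M-column₀ (suc i))) ⟩
        (L (suc i) zero * U zero (suc k) + S) + w k * L (suc i) zero
          ≈⟨ solve 3 (λ a s b → (a :+ s) :+ b := s :+ (a :+ b)) refl _ S _ ⟩
        S + (L (suc i) zero * U zero (suc k) + w k * L (suc i) zero)
          ≈⟨ +-congˡ (*-comm-cancel _ _) ⟩
        S + 0#
          ≈⟨ +-identityʳ S ⟩
        S ∎
        where S = ∑ (λ l → L (suc i) (suc l) * U (suc l) (suc k))

      trailing : det (minor M′ zero) ≈ ∏ (λ i → L (suc i) (suc i))
      trailing = det-LU (λ i k → L (suc i) (suc k)) (λ k j → U (suc k) (suc j)) (minor M′ zero)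
        (λ i k → L-lower (suc i) (suc k) ∘ s<s) (λ k j → U-upper (suc k) (suc j) ∘ s<s) (U-diag ∘ suc) M′-minor

module MöbiusInversion {c ℓ} (R : CommutativeRing c ℓ) where
  open CommutativeRing R hiding (zero)
  open RingOps R
  open Sums R
  open import Relation.Binary.Reasoning.Setoid setoid

  module _ {m r} {_≤_ : Rel (Fin m) r} (_≤?_ : Decidable _≤_) (≤-isPreorder : IsPreorder _≡_ _≤_)
           {μ : Fin m → Fin m → Carrier} (μ-isMobius : IsMobius _≤_ _≤?_ μ) where
    open IsPreorder ≤-isPreorder using () renaming (reflexive to ≤-reflexive; trans to ≤-trans)

    ∑-μ-below : ∀ c x → ∑ (λ d → when (d ≤? x) (μ c d)) ≈ δ c x
    ∑-μ-below c x = trans (∑-cong μ-restrict) (interval-sum (c ≤? x))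
      where
        μ-restrict : ∀ d → when (d ≤? x) (μ c d) ≈ when ((c ≤? d) ×-dec (d ≤? x)) (μ c d)
        μ-restrict d with c ≤? d | d ≤? x
        ... | yes _   | yes _ = refl
        ... | no c≰d  | yes _ = proj₁ μ-isMobius c d c≰d
        ... | yes _   | no _  = refl
        ... | no _    | no _  = refl

        interval-sum : Dec (c ≤ x) → ∑∣ (λ d → (c ≤? d) ×-dec (d ≤? x)) (μ c) ≈ δ c x
        interval-sum (yes c≤x) = proj₂ μ-isMobius c x c≤x
        interval-sum (no c≰x)  = trans
          (∑-zero λ d → when-no ((c ≤? d) ×-dec (d ≤? x)) λ (c≤d , d≤x) → c≰x (≤-trans c≤d d≤x))
          (sym (when-no (c ≟ x) (c≰x ∘ ≤-reflexive)))

    möbius-inversion : ∀ (F : Fin m → Carrier) x → ∑ (λ d → when (d ≤? x) (∑ (λ c → μ c d * F c))) ≈ F x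
    möbius-inversion F x = begin
      ∑ (λ d → when (d ≤? x) (∑ (λ c → μ c d * F c)))
        ≈⟨ ∑-cong (λ d → when-∑ (d ≤? x) (λ c → μ c d * F c)) ⟩
      ∑ (λ d → ∑ (λ c → when (d ≤? x) (μ c d * F c)))
        ≈⟨ ∑-comm (λ d c → when (d ≤? x) (μ c d * F c)) ⟩
      ∑ (λ c → ∑ (λ d → when (d ≤? x) (μ c d * F c)))
        ≈⟨ ∑-cong (λ c → ∑-cong (λ d → when-*ʳ (d ≤? x) (μ c d) (F c))) ⟨
      ∑ (λ c → ∑ (λ d → when (d ≤? x) (μ c d) * F c))
        ≈⟨ ∑-cong (λ c → *-distribʳ-∑ (F c) (λ d → when (d ≤? x) (μ c d))) ⟨
      ∑ (λ c → ∑ (λ d → when (d ≤? x) (μ c d)) * F c)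
        ≈⟨ ∑-cong (λ c → *-congʳ (∑-μ-below c x)) ⟩
      ∑ (λ c → δ c x * F c)
        ≈⟨ ∑-single (λ c → δ c x * F c) x (λ c c≢x → trans (*-congʳ (when-no (c ≟ x) c≢x)) (zeroˡ _)) ⟩
      δ x x * F x
        ≈⟨ trans (*-congʳ (when-yes (x ≟ x) ≡.refl)) (*-identityˡ _) ⟩
      F x ∎

module _ {m n r} (_≤_ : Rel (Fin m) r) (a : Fin n → Fin m) where

  ⊴-unique : ∀ {d k l} → ⊴ _≤_ a d k → ⊴ _≤_ a d l → k ≡ l
  ⊴-unique {k = k} {l} (d≤aₖ , below-k) (d≤aₗ , below-l) with <-cmp k l
  ... | tri< k<l _   _   = ⊥-elim (below-l k k<l d≤aₖ)
  ... | tri≈ _   k≡l _   = k≡l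
  ... | tri> _   _   l<k = ⊥-elim (below-k l l<k d≤aₗ)

  ⊴-exists : Decidable _≤_ → ∀ {d i} → d ≤ a i → Σ (Fin n) (⊴ _≤_ a d)
  ⊴-exists _≤?_ {d} = least-witness (λ k → d ≤? a k) _

module MeetClosedListing {m n r} {_≤_ : Rel (Fin m) r} {_∧_ : Fin m → Fin m → Fin m}
  (isMeetSemilattice : IsMeetSemilattice _≡_ _≤_ _∧_)
  (a : Fin n → Fin m) (a-injective : Injective _≡_ _≡_ a)
  (meet-closed : ∀ i j → Σ (Fin n) (λ k → a k ≡ (a i ∧ a j)))
  (linear-extension : ∀ i j → a i ≤ a j → a i ≢ a j → i < j) where
  open IsMeetSemilattice isMeetSemilattice using (x∧y≤x; x∧y≤y; ∧-greatest)

  index<⇒≰ : ∀ {i k} → i < k → ¬ (a k ≤ a i)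
  index<⇒≰ {i} {k} i<k aₖ≤aᵢ with a k ≟ a i
  ... | yes aₖ≡aᵢ = <-irrefl (≡.sym (a-injective aₖ≡aᵢ)) i<k
  ... | no  aₖ≢aᵢ = <-asym i<k (linear-extension k i aₖ≤aᵢ aₖ≢aᵢ)

  -- The meet a_k ∧ a_x lies in S and above d, so by minimality of k it cannot lie strictly below a_k.
  ⊴-least : ∀ {d k x} → ⊴ _≤_ a d k → d ≤ a x → a k ≤ a x
  ⊴-least {d} {k} {x} (d≤aₖ , below-k) d≤aₓ with meet-closed k x
  ... | l , aₗ≡aₖ∧aₓ with a l ≟ a k
  ...   | yes aₗ≡aₖ = ≡.subst (_≤ a x) (≡.trans (≡.sym aₗ≡aₖ∧aₓ) aₗ≡aₖ) (x∧y≤y (a k) (a x))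
  ...   | no  aₗ≢aₖ = ⊥-elim (below-k l
            (linear-extension l k (≡.subst (_≤ a k) (≡.sym aₗ≡aₖ∧aₓ) (x∧y≤x (a k) (a x))) aₗ≢aₖ)
            (≡.subst (d ≤_) (≡.sym aₗ≡aₖ∧aₓ) (∧-greatest d≤aₖ d≤aₓ)))

module MeetMatrixFactorisation {c ℓ r} (R : CommutativeRing c ℓ)
  {m : ℕ} {_≤_ : Rel (Fin m) r} (_≤?_ : Decidable _≤_) {_∧_ : Fin m → Fin m → Fin m}
  (isMeetSemilattice : IsMeetSemilattice _≡_ _≤_ _∧_)
  {μ : Fin m → Fin m → CommutativeRing.Carrier R} (μ-isMobius : RingOps.IsMobius R _≤_ _≤?_ μ)
  (f : Fin m → Fin m → CommutativeRing.Carrier R)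
  {n : ℕ} (a : Fin n → Fin m) (a-injective : Injective _≡_ _≡_ a)
  (meet-closed : ∀ i j → Σ (Fin n) (λ k → a k ≡ (a i ∧ a j)))
  (linear-extension : ∀ i j → a i ≤ a j → a i ≢ a j → i < j) where

  open CommutativeRing R hiding (zero)
  open RingOps R
  open Sums R
  open Determinants R using (Matrix)
  open MöbiusInversion R using (möbius-inversion)
  open MeetClosedListing isMeetSemilattice a a-injective meet-closed linear-extension
  open IsMeetSemilattice isMeetSemilattice
    using (isPreorder; x∧y≤x; x∧y≤y; ∧-greatest) renaming (refl to ≤-refl; trans to ≤-trans)
  open import Relation.Binary.Reasoning.Setoid setoid

  μf : Fin n → Fin m → Carrier
  μf i d = ∑ (λ c → μ c d * f c (a i))

  L : Matrix n
  L i k = when (a k ≤? a i) (∑∣ (⊴? _≤?_ a k) (μf i))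

  U : Matrix n
  U k j = when (a k ≤? a j) 1#

  L-lower : ∀ i k → i < k → L i k ≈ 0#
  L-lower i k i<k = when-no (a k ≤? a i) (index<⇒≰ i<k)

  U-upper : ∀ k j → j < k → U k j ≈ 0#
  U-upper k j j<k = when-no (a k ≤? a j) (index<⇒≰ j<k)

  U-diag : ∀ k → U k k ≈ 1#
  U-diag k = when-yes (a k ≤? a k) ≤-refl

  L-diag : ∀ i → L i i ≈ ∑∣ (⊴? _≤?_ a i) (μf i)
  L-diag i = when-yes (a i ≤? a i) ≤-refl

  ⊴-below? : ∀ i j d k → Dec (a k ≤ a j × (a k ≤ a i × ⊴ _≤_ a d k))
  ⊴-below? i j d k = (a k ≤? a j) ×-dec ((a k ≤? a i) ×-dec ⊴? _≤?_ a k d)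

  ∑-⊴-below : ∀ i j d v → ∑ (λ k → when (⊴-below? i j d k) v) ≈ when (d ≤? (a i ∧ a j)) v
  ∑-⊴-below i j d = ∑-when-unique (⊴-below? i j d) (d ≤? (a i ∧ a j))
    (λ (_ , _ , d⊴aₖ) (_ , _ , d⊴aₗ) → ⊴-unique _≤_ a d⊴aₖ d⊴aₗ)
    (λ (aₖ≤aⱼ , aₖ≤aᵢ , d≤aₖ , _) → ∧-greatest (≤-trans d≤aₖ aₖ≤aᵢ) (≤-trans d≤aₖ aₖ≤aⱼ))
    witness
    where
      witness : d ≤ (a i ∧ a j) → Σ (Fin n) (λ k → a k ≤ a j × (a k ≤ a i × ⊴ _≤_ a d k))
      witness d≤aᵢ∧aⱼ =
        let d≤aᵢ = ≤-trans d≤aᵢ∧aⱼ (x∧y≤x (a i) (a j))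
            d≤aⱼ = ≤-trans d≤aᵢ∧aⱼ (x∧y≤y (a i) (a j))
            k , d⊴aₖ = ⊴-exists _≤_ a _≤?_ d≤aᵢ
        in k , ⊴-least d⊴aₖ d≤aⱼ , ⊴-least d⊴aₖ d≤aᵢ , d⊴aₖ

  factorisation : ∀ i j → f (a i ∧ a j) (a i) ≈ ∑ (λ k → L i k * U k j)
  factorisation i j = sym (begin
    ∑ (λ k → L i k * U k j)
      ≈⟨ ∑-cong entry ⟩
    ∑ (λ k → ∑ (λ d → when (⊴-below? i j d k) (μf i d)))
      ≈⟨ ∑-comm (λ k d → when (⊴-below? i j d k) (μf i d)) ⟩
    ∑ (λ d → ∑ (λ k → when (⊴-below? i j d k) (μf i d)))
      ≈⟨ ∑-cong (λ d → ∑-⊴-below i j d (μf i d)) ⟩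
    ∑ (λ d → when (d ≤? (a i ∧ a j)) (μf i d))
      ≈⟨ möbius-inversion _≤?_ isPreorder μ-isMobius (λ c → f c (a i)) (a i ∧ a j) ⟩
    f (a i ∧ a j) (a i) ∎)
    where
      entry : ∀ k → L i k * U k j ≈ ∑ (λ d → when (⊴-below? i j d k) (μf i d))
      entry k = begin
        L i k * when (a k ≤? a j) 1#
          ≈⟨ *-when-1# (a k ≤? a j) (L i k) ⟩
        when (a k ≤? a j) (when (a k ≤? a i) (∑ (λ d → when (⊴? _≤?_ a k d) (μf i d))))
          ≈⟨ when-cong (a k ≤? a j) (when-∑ (a k ≤? a i) (λ d → when (⊴? _≤?_ a k d) (μf i d))) ⟩
        when (a k ≤? a j) (∑ (λ d → when (a k ≤? a i) (when (⊴? _≤?_ a k d) (μf i d))))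
          ≈⟨ when-∑ (a k ≤? a j) (λ d → when (a k ≤? a i) (when (⊴? _≤?_ a k d) (μf i d))) ⟩
        ∑ (λ d → when (a k ≤? a j) (when (a k ≤? a i) (when (⊴? _≤?_ a k d) (μf i d))))
          ≈⟨ ∑-cong (λ d → trans (when-cong (a k ≤? a j) (when-when (a k ≤? a i) (⊴? _≤?_ a k d) (μf i d)))
                                 (when-when (a k ≤? a j) ((a k ≤? a i) ×-dec ⊴? _≤?_ a k d) (μf i d))) ⟩
        ∑ (λ d → when (⊴-below? i j d k) (μf i d)) ∎

-- f need not lie in the incidence algebra: Möbius inversion holds for every function.
theorem4p1 : ∀ {c ℓ r : Level} (R : CommutativeRing c ℓ) →
    let open CommutativeRing R in
    let open RingOps R in
    -- the finite meet semilattice L, with carrier Fin m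
    (m : ℕ) (_≤_ : Rel (Fin m) r) (_≤?_ : Decidable _≤_) (_∧_ : Fin m → Fin m → Fin m) →
    IsMeetSemilattice _≡_ _≤_ _∧_ →
    -- its Möbius function μ and an element f of the incidence algebra I(L,R)
    (μ : Fin m → Fin m → Carrier) → IsMobius _≤_ _≤?_ μ →
    (f : Fin m → Fin m → Carrier) → InIncidence _≤_ f →
    -- S = {a_1, ..., a_n} ⊆ L, listed without repetition
    (n : ℕ) (a : Fin n → Fin m) → Injective _≡_ _≡_ a →
    -- S is meet closed
    (∀ i j → Σ (Fin n) (λ k → a k ≡ (a i ∧ a j))) →
    -- the listing is a linear extension: a_i < a_j implies i < j
    (∀ i j → a i ≤ a j → a i ≢ a j → i < j) →
    det (λ i j → f (a i ∧ a j) (a i))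
      ≈ ∏ (λ i → ∑∣ (⊴? _≤?_ a i) (λ d → ∑ (λ c → μ c d * f c (a i))))
theorem4p1 R m _≤_ _≤?_ _∧_ isMeetSemilattice μ μ-isMobius f _ n a a-injective meet-closed linear-extension =
  trans (det-LU L U _ L-lower U-upper U-diag factorisation) (∏-cong L-diag)
  where
    open CommutativeRing R using (trans)
    open Sums R using (∏-cong)
    open Determinants R using (det-LU)
    open MeetMatrixFactorisation R _≤?_ isMeetSemilattice μ-isMobius f a a-injective meet-closed linear-extension
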